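{- Let $A$ be a finite alphabet, let $S\subseteq A^*$ be a recurrent neutral set, let $X\subseteq S$ be a finite $S$-maximal bifix code, and let $f:B^*\to A^*$ be a coding morphism for $X$. Then $f^{ -1}(S)\subseteq B^*$ is a neutral set and $\chi(f^{ -1}(S))=\chi(S)$.
   Context: A set $S\subseteq A^*$ is factorial if it contains all factors of its elements. For $w\in S$: $\ell_S(w)=\mathrm{Card}\{a\in A: aw\in S\}$, $r_S(w)=\mathrm{Card}\{a\in A: wa\in S\}$, $e_S(w)=\mathrm{Card}\{(a,b)\in A\times A: awb\in S\}$, $m_S(w)=e_S(w)-\ell_S(w)-r_S(w)+1$ (and analogously for subsets of $B^*$ with letters of $B$). A set is neutral if it is factorial and $m(w)=0$ for every nonempty word $w$ in it; its characteristic is $\chi=1-m(\varepsilon)$. $S\neq\{\varepsilon\}$ is recurrent if it is factorial and for all $u,w\in S$ there is $v\in S$ with $uvw\in S$. A bifix code is a set of nonempty words none of which is a proper prefix or proper suffix of another; a bifix code $X\subseteq S$ is $S$-maximal if it is not properly contained in a bifix code $Y\subseteq S$. A coding morphism for $X$ is a monoid morphism $f:B^*\to A^*$ mapping an alphabet $B$ bijectively onto $X$. -}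

module Defs where

open import Level using (0ℓ)
open import Data.Nat using (ℕ; suc)
open import Data.Fin using (Fin)
open import Data.List using (List; []; _∷_; _++_; [_]; filter; length; cartesianProduct)
open import Data.List.Membership.Propositional using (_∈_)
open import Data.Fin using (Fin)
open import Data.Fin.Base using ()
open import Data.List.Base using (allFin)
open import Data.Integer using (ℤ; +_; _-_; _+_)
open import Data.Product using (Σ; ∃; _×_; _,_; proj₁; proj₂)
open import Relation.Nullary using (¬_; Dec)
open import Relation.Unary using (Pred; Decidable; _⊆_)
open import Relation.Binary.PropositionalEquality using (_≡_; _≢_)
open import Function.Bundles using (_⇔_)

Word : ℕ → Set
Word k = List (Fin k)

-- A set of words is a predicate; counting requires a decision procedure.
WordSet : ℕ → Set₁
WordSet k = Pred (Word k) 0ℓ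

module _ {k : ℕ} (S : WordSet k) (S? : Decidable S) where

  ℓS : Word k → ℕ
  ℓS w = length (filter (λ a → S? (a ∷ w)) (allFin k))

  rS : Word k → ℕ
  rS w = length (filter (λ a → S? (w ++ [ a ])) (allFin k))

  eS : Word k → ℕ
  eS w = length (filter (λ p → S? (proj₁ p ∷ (w ++ [ proj₂ p ])))
                        (cartesianProduct (allFin k) (allFin k)))

  mS : Word k → ℤ
  mS w = ((+ eS w) - (+ ℓS w)) - (+ rS w) + (+ 1)

  χ : ℤ
  χ = (+ 1) - mS []

Factorial : ∀ {k} → WordSet k → Set
Factorial S = ∀ u v w → S (u ++ v ++ w) → S v

Neutral : ∀ {k} (S : WordSet k) → Decidable S → Set
Neutral S S? = Factorial S × (∀ w → w ≢ [] → S w → mS S S? w ≡ + 0)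

Recurrent : ∀ {k} → WordSet k → Set
Recurrent S =
  (¬ (∀ w → (S w ⇔ (w ≡ []))))
  × Factorial S
  × (∀ u w → S u → S w → ∃ λ v → S v × S (u ++ v ++ w))

BifixCode : ∀ {k} → WordSet k → Set
BifixCode X =
  (∀ x → X x → x ≢ [])
  × (∀ x y z → X x → X y → z ≢ [] → x ++ z ≢ y)
  × (∀ x y z → X x → X y → z ≢ [] → z ++ x ≢ y)

SMaximalBifixCode : ∀ {k} → WordSet k → WordSet k → Set₁
SMaximalBifixCode S X =
  BifixCode X × X ⊆ S
  × (∀ (Y : WordSet _) → BifixCode Y → Y ⊆ S → X ⊆ Y → Y ⊆ X)

Finite : ∀ {k} → WordSet k → Set
Finite {k} X = ∃ λ (xs : List (Word k)) → ∀ x → X x ⇔ (x ∈ xs)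

IsMonoidMorphism : ∀ {m k} → (Word m → Word k) → Set
IsMonoidMorphism f = (f [] ≡ []) × (∀ u v → f (u ++ v) ≡ f u ++ f v)

IsCodingMorphism : ∀ {m k} → (Word m → Word k) → WordSet k → Set
IsCodingMorphism f X =
  IsMonoidMorphism f
  × (∀ b → X (f [ b ]))
  × (∀ b c → f [ b ] ≡ f [ c ] → b ≡ c)
  × (∀ x → X x → ∃ λ b → f [ b ] ≡ x)

preimage : ∀ {m k} → (Word m → Word k) → WordSet k → WordSet m
preimage f S u = S (f u)

preimage? : ∀ {m k} (f : Word m → Word k) (S : WordSet k) → Decidable S → Decidable (preimage f S)
preimage? f S S? u = S? (f u)

-- Let s be the indicator of S, ℓ(u), r(u), e(u) the numbers of letters a, b with au, ub, aub ∈ S,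
-- and t(u) = e(u) − ℓ(u) − r(u) + s(u): t = m_S on S, t = 0 off S, and neutrality is t(u) = 0
-- for u ≠ ε.  As f maps B bijectively onto X, the counts of T = f⁻¹(S) at w are the counts ℓX,
-- rX, eX of S at y = f(w) in which the extending letters are replaced by words of X.
-- The key combinatorial fact (SuffixCovering: recurrence, S-maximality, pigeonhole) is that
-- every word of S has a suffix in X or is a suffix of a word of X, and dually for prefixes.
-- It makes the proper suffixes and proper prefixes of X grow inside S like trees (CodeTrees),
-- which gives the counting identity (TreeIdentity)
--     eX(y) − rX(y) − ℓX(y) + s(y) = Σ_{p proper suffix, q proper prefix} t(p y q).
-- For y ≠ ε the right side vanishes, so m_T(w) = 0; for y = ε only p = q = ε survives, so
-- m_T(ε) = m_S(ε).
module Submission where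

open import Defs
open import Data.Nat using (ℕ)
open import Data.Product using (_×_)
open import Relation.Unary using (Decidable)
open import Relation.Binary.PropositionalEquality using (_≡_)

open import Data.Nat as ℕ using (zero; suc; _≤_; _<_; z≤n; s≤s)
import Data.Nat.Properties as ℕₚ
open import Data.Fin using (Fin; zero; suc; toℕ; fromℕ<)
import Data.Fin.Properties as Finₚ
open import Data.Product using (Σ; ∃; ∃₂; _,_; proj₁; proj₂)
open import Data.List using (List; []; _∷_; _++_; [_]; length; filter; map; tabulate; allFin; cartesianProduct; reverse)
open import Data.List.Properties
  using (≡-dec; ∷-injective; ++-assoc; ++-identityʳ; ++-identityʳ-unique; ++-identityˡ-unique; length-++-≤ˡ; length-++-≤ʳ; ++-conicalˡ; ++-conicalʳ;
         reverse-++; reverse-involutive; length-reverse)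
open import Data.Integer using (ℤ; +_; _+_; _*_; -_; _-_; 0ℤ; 1ℤ)
open import Data.Integer.Properties
open import Data.Integer.Tactic.RingSolver using (solve-∀)
open import Algebra.Properties.CommutativeSemigroup +-commutativeSemigroup using (interchange)
open import Data.Sum using (_⊎_; inj₁; inj₂) renaming ([_,_] to either)
open import Data.Empty using (⊥; ⊥-elim)
open import Data.Unit using (⊤; tt)
open import Relation.Nullary using (¬_; Dec; yes; no)
open import Relation.Nullary.Decidable using (map′)
open import Relation.Unary using (Pred; _⊆_)
open import Data.List.Membership.Propositional using (_∈_; find; lose)
open import Data.List.Relation.Unary.Any using (here; there; any?)
open import Function.Bundles using (Equivalence; mk⇔)
open import Relation.Binary.PropositionalEquality using (refl; sym; trans; cong; cong₂; subst; _≢_; module ≡-Reasoning)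
open ≡-Reasoning

𝟙 : ∀ {p} {P : Set p} → Dec P → ℤ
𝟙 (yes _) = 1ℤ
𝟙 (no _)  = 0ℤ

𝟙-yes : ∀ {p} {P : Set p} → P → (d : Dec P) → 𝟙 d ≡ 1ℤ
𝟙-yes _ (yes _) = refl
𝟙-yes p (no ¬p) = ⊥-elim (¬p p)

𝟙-no : ∀ {p} {P : Set p} → ¬ P → (d : Dec P) → 𝟙 d ≡ 0ℤ
𝟙-no ¬p (yes p) = ⊥-elim (¬p p)
𝟙-no _  (no _)  = refl

𝟙-⇔ : ∀ {p q} {P : Set p} {Q : Set q} → (P → Q) → (Q → P) → (d : Dec P) (e : Dec Q) → 𝟙 d ≡ 𝟙 e
𝟙-⇔ to from (yes p) e = sym (𝟙-yes (to p) e)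
𝟙-⇔ to from (no ¬p) e = sym (𝟙-no (λ q → ¬p (from q)) e)

𝟙-exclusive-sum : ∀ {P Q R : Set} → (P → Q ⊎ R) → (Q → P) → (R → P) → (Q → R → ⊥) →
  (d : Dec P) (dQ : Dec Q) (dR : Dec R) → 𝟙 d ≡ 𝟙 dQ + 𝟙 dR
𝟙-exclusive-sum to Q⇒P R⇒P excl (yes _)  (yes q)  (yes r)  = ⊥-elim (excl q r)
𝟙-exclusive-sum to Q⇒P R⇒P excl (yes _)  (yes _)  (no _)   = refl
𝟙-exclusive-sum to Q⇒P R⇒P excl (yes _)  (no _)   (yes _)  = refl
𝟙-exclusive-sum to Q⇒P R⇒P excl (yes p)  (no ¬q)  (no ¬r)  = ⊥-elim (either ¬q ¬r (to p))
𝟙-exclusive-sum to Q⇒P R⇒P excl (no ¬p)  (yes q)  _        = ⊥-elim (¬p (Q⇒P q))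
𝟙-exclusive-sum to Q⇒P R⇒P excl (no ¬p)  (no _)   (yes r)  = ⊥-elim (¬p (R⇒P r))
𝟙-exclusive-sum to Q⇒P R⇒P excl (no _)   (no _)   (no _)   = refl

𝟙-weighted : ∀ {p} {P : Set p} (d : Dec P) {g h : ℤ} → (P → g ≡ h) → g * 𝟙 d ≡ h * 𝟙 d
𝟙-weighted (yes p) g≡h = cong (_* 1ℤ) (g≡h p)
𝟙-weighted (no _) {g} {h} _ = trans (*-zeroʳ g) (sym (*-zeroʳ h))

record Linear {A : Set} (Φ : (A → ℤ) → ℤ) : Set where
  field
    Σ-cong : ∀ {g h} → (∀ a → g a ≡ h a) → Φ g ≡ Φ h
    Σ-0    : Φ (λ _ → 0ℤ) ≡ 0ℤ
    Σ-+    : ∀ g h → Φ (λ a → g a + h a) ≡ Φ g + Φ h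
    Σ-*    : ∀ c g → Φ (λ a → c * g a) ≡ c * Φ g

  Σ-neg : ∀ g → Φ (λ a → - g a) ≡ - Φ g
  Σ-neg g = trans (Σ-cong (λ a → sym (-1*i≡-i (g a)))) (trans (Σ-* (- 1ℤ) g) (-1*i≡-i (Φ g)))

  Σ-- : ∀ g h → Φ (λ a → g a - h a) ≡ Φ g - Φ h
  Σ-- g h = trans (Σ-+ g (λ a → - h a)) (cong (_+_ (Φ g)) (Σ-neg h))

  Σ-vanish : ∀ {g} → (∀ a → g a ≡ 0ℤ) → Φ g ≡ 0ℤ
  Σ-vanish p = trans (Σ-cong p) Σ-0
open Linear public

Interchangeable : {A : Set} → ((A → ℤ) → ℤ) → Set₁
Interchangeable {A} Φ = ∀ {B : Set} (Ψ : (B → ℤ) → ℤ) → Linear Ψ → (g : A → B → ℤ) →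
  Φ (λ a → Ψ (g a)) ≡ Ψ (λ b → Φ (λ a → g a b))

sumFin : ∀ {n} → (Fin n → ℤ) → ℤ
sumFin {zero}  g = 0ℤ
sumFin {suc n} g = g zero + sumFin (λ i → g (suc i))

sumFin-linear : ∀ {n} → Linear (sumFin {n})
sumFin-linear {zero} = record
  { Σ-cong = λ _ → refl ; Σ-0 = refl ; Σ-+ = λ _ _ → refl ; Σ-* = λ c _ → sym (*-zeroʳ c) }
sumFin-linear {suc n} = record
  { Σ-cong = λ p → cong₂ _+_ (p zero) (Σ-cong L (λ i → p (suc i)))
  ; Σ-0    = trans (+-identityˡ _) (Σ-0 L)
  ; Σ-+    = λ g h → trans (cong (_+_ (g zero + h zero)) (Σ-+ L _ _)) (interchange (g zero) (h zero) _ _)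
  ; Σ-*    = λ c g → trans (cong (_+_ (c * g zero)) (Σ-* L c _)) (sym (*-distribˡ-+ c (g zero) _))
  }
  where L = sumFin-linear {n}

sumFin-interchange : ∀ {n} → Interchangeable (sumFin {n})
sumFin-interchange {zero}  Ψ L g = sym (Σ-0 L)
sumFin-interchange {suc n} Ψ L g =
  trans (cong (_+_ (Ψ (g zero))) (sumFin-interchange Ψ L (λ i → g (suc i)))) (sym (Σ-+ L _ _))

sumFin-delta : ∀ {n} (c : Fin n) (g : Fin n → ℤ) → sumFin (λ a → 𝟙 (a Finₚ.≟ c) * g a) ≡ g c
sumFin-delta {suc n} zero g =
  trans (cong₂ _+_ (*-identityˡ (g zero))
          (Σ-vanish sumFin-linear (λ i → trans (cong (_* g (suc i)) (𝟙-no (λ ()) (suc i Finₚ.≟ zero))) (*-zeroˡ (g (suc i))))))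
        (+-identityʳ _)
sumFin-delta {suc n} (suc c) g =
  trans (cong₂ _+_ (*-zeroˡ (g zero))
          (trans (Σ-cong sumFin-linear (λ i → cong (_* g (suc i))
                   (𝟙-⇔ Finₚ.suc-injective (cong suc) (suc i Finₚ.≟ suc c) (i Finₚ.≟ c))))
                 (sumFin-delta c (λ i → g (suc i)))))
        (+-identityˡ _)

sumWords : ∀ {k} → ℕ → (Word k → ℤ) → ℤ
sumWords zero    g = g []
sumWords (suc n) g = g [] + sumFin (λ a → sumWords n (λ p → g (a ∷ p)))

-- The same sum grown by appending letters; needed to read words from the right.
sumWordsʳ : ∀ {k} → ℕ → (Word k → ℤ) → ℤ
sumWordsʳ zero    g = g []
sumWordsʳ (suc n) g = g [] + sumFin (λ b → sumWordsʳ n (λ q → g (q ++ [ b ])))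

-- Both sums are built by the same step g ↦ g(ε) + Σ_a Φ(p ↦ g(a ⊙ p)), which preserves linearity.
linear-step : ∀ {k} {Φ : (Word k → ℤ) → ℤ} (_⊙_ : Fin k → Word k → Word k) → Linear Φ →
  Linear (λ g → g [] + sumFin (λ a → Φ (λ p → g (a ⊙ p))))
linear-step {k} _⊙_ L = record
  { Σ-cong = λ p → cong₂ _+_ (p []) (Σ-cong F (λ a → Σ-cong L (λ q → p (a ⊙ q))))
  ; Σ-0    = trans (+-identityˡ _) (Σ-vanish F (λ a → Σ-0 L))
  ; Σ-+    = λ g h → trans (cong (_+_ (g [] + h [])) (trans (Σ-cong F (λ a → Σ-+ L _ _)) (Σ-+ F _ _)))
                           (interchange (g []) (h []) _ _)
  ; Σ-*    = λ c g → trans (cong (_+_ (c * g [])) (trans (Σ-cong F (λ a → Σ-* L c _)) (Σ-* F c _)))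
                           (sym (*-distribˡ-+ c (g []) _))
  }
  where F = sumFin-linear {k}

sumWords-linear : ∀ {k} n → Linear (sumWords {k} n)
sumWords-linear zero    = record { Σ-cong = λ p → p [] ; Σ-0 = refl ; Σ-+ = λ _ _ → refl ; Σ-* = λ _ _ → refl }
sumWords-linear (suc n) = linear-step _∷_ (sumWords-linear n)

sumWordsʳ-linear : ∀ {k} n → Linear (sumWordsʳ {k} n)
sumWordsʳ-linear zero    = record { Σ-cong = λ p → p [] ; Σ-0 = refl ; Σ-+ = λ _ _ → refl ; Σ-* = λ _ _ → refl }
sumWordsʳ-linear (suc n) = linear-step (λ b q → q ++ [ b ]) (sumWordsʳ-linear n)

sumWords-interchange : ∀ {k} n → Interchangeable (sumWords {k} n)
sumWords-interchange zero    Ψ L g = refl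
sumWords-interchange {k} (suc n) Ψ L g =
  trans (cong (_+_ (Ψ (g [])))
          (trans (Σ-cong (sumFin-linear {k}) (λ a → sumWords-interchange n Ψ L (λ p → g (a ∷ p))))
                 (sumFin-interchange {k} Ψ L _)))
        (sym (Σ-+ L _ _))

mutual
  sumWordsʳ≡sumWords : ∀ {k} n (g : Word k → ℤ) → sumWordsʳ n g ≡ sumWords n g
  sumWordsʳ≡sumWords zero    g = refl
  sumWordsʳ≡sumWords {k} (suc n) g = cong (_+_ (g []))
    (trans (Σ-cong (sumFin-linear {k}) (λ b → sumWordsʳ≡sumWords n _))
    (trans (last↔first n g)
           (Σ-cong (sumFin-linear {k}) (λ a → sumWordsʳ≡sumWords n _))))

  last↔first : ∀ {k} n (g : Word k → ℤ) →
    sumFin (λ b → sumWords n (λ q → g (q ++ [ b ]))) ≡ sumFin (λ a → sumWordsʳ n (λ q → g (a ∷ q)))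
  last↔first zero    g = refl
  last↔first {k} (suc n) g =
    trans (Σ-+ F (λ b → g [ b ]) (λ b → sumFin (λ a → sumWords n (λ p → g (a ∷ p ++ [ b ])))))
    (trans (cong (_+_ (sumFin (λ b → g [ b ])))
             (trans (Σ-cong F (λ b → Σ-cong F (λ a → sym (sumWordsʳ≡sumWords n (λ p → g (a ∷ p ++ [ b ]))))))
                    (sumFin-interchange {k} sumFin F (λ b a → sumWordsʳ n (λ p → g (a ∷ p ++ [ b ]))))))
    (sym (Σ-+ F (λ a → g [ a ]) (λ a → sumFin (λ b → sumWordsʳ n (λ q → g (a ∷ q ++ [ b ])))))))
    where F = sumFin-linear {k}

sumWords-root : ∀ {k} n (g : Word k → ℤ) → (∀ a p → g (a ∷ p) ≡ 0ℤ) → sumWords n g ≡ g []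
sumWords-root zero    g h = refl
sumWords-root (suc n) g h =
  trans (cong (_+_ (g [])) (Σ-vanish sumFin-linear (λ a → Σ-vanish (sumWords-linear n) (h a)))) (+-identityʳ _)

sumWords-extend : ∀ {k} n (g : Word k → ℤ) → (∀ z → n < length z → g z ≡ 0ℤ) → sumWords (suc n) g ≡ sumWords n g
sumWords-extend zero    g h = trans (cong (_+_ (g [])) (Σ-vanish sumFin-linear (λ a → h [ a ] (s≤s z≤n)))) (+-identityʳ _)
sumWords-extend (suc n) g h = cong (_+_ (g []))
  (Σ-cong sumFin-linear (λ a → sumWords-extend n (λ p → g (a ∷ p)) (λ z lt → h (a ∷ z) (s≤s lt))))

_≟W_ : ∀ {k} (u v : Word k) → Dec (u ≡ v)
_≟W_ = ≡-dec Finₚ._≟_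

sumWords-delta : ∀ {k} n (x : Word k) (g : Word k → ℤ) → length x ≤ n →
  sumWords n (λ z → 𝟙 (z ≟W x) * g z) ≡ g x
sumWords-delta n [] g _ =
  trans (sumWords-root n _ (λ a p → trans (cong (_* g (a ∷ p)) (𝟙-no (λ ()) ((a ∷ p) ≟W []))) (*-zeroˡ (g (a ∷ p)))))
        (*-identityˡ (g []))
sumWords-delta (suc n) (c ∷ x) g (s≤s |x|≤n) =
  trans (cong₂ _+_ (*-zeroˡ (g []))
          (trans (Σ-cong sumFin-linear (λ a → split a)) (sumFin-delta c (λ a → g (a ∷ x)))))
        (+-identityˡ _)
  where
  𝟙-∷ : ∀ a p → 𝟙 ((a ∷ p) ≟W (c ∷ x)) ≡ 𝟙 (a Finₚ.≟ c) * 𝟙 (p ≟W x)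
  𝟙-∷ a p = product (a Finₚ.≟ c) (p ≟W x)
    where
    product : (d₁ : Dec (a ≡ c)) (d₂ : Dec (p ≡ x)) → 𝟙 ((a ∷ p) ≟W (c ∷ x)) ≡ 𝟙 d₁ * 𝟙 d₂
    product (yes refl) (yes refl) = 𝟙-yes refl ((a ∷ p) ≟W (c ∷ x))
    product (yes _)    (no p≢x)   = 𝟙-no (λ e → p≢x (proj₂ (∷-injective e))) ((a ∷ p) ≟W (c ∷ x))
    product (no a≢c)   _          = 𝟙-no (λ e → a≢c (proj₁ (∷-injective e))) ((a ∷ p) ≟W (c ∷ x))
  split : ∀ a → sumWords n (λ p → 𝟙 ((a ∷ p) ≟W (c ∷ x)) * g (a ∷ p)) ≡ 𝟙 (a Finₚ.≟ c) * g (a ∷ x)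
  split a =
    trans (Σ-cong (sumWords-linear n) (λ p → trans (cong (_* g (a ∷ p)) (𝟙-∷ a p)) (*-assoc (𝟙 (a Finₚ.≟ c)) _ _)))
    (trans (Σ-* (sumWords-linear n) (𝟙 (a Finₚ.≟ c)) (λ p → 𝟙 (p ≟W x) * g (a ∷ p)))
           (cong (𝟙 (a Finₚ.≟ c) *_) (sumWords-delta n x (λ p → g (a ∷ p)) |x|≤n)))

sumList : ∀ {a} {A : Set a} → List A → (A → ℤ) → ℤ
sumList []       g = 0ℤ
sumList (x ∷ xs) g = g x + sumList xs g

count-sumList : ∀ {a p} {A : Set a} {P : Pred A p} (P? : Decidable P) (xs : List A) →
  + length (filter P? xs) ≡ sumList xs (λ x → 𝟙 (P? x))
count-sumList P? [] = refl
count-sumList P? (x ∷ xs) with P? x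
... | yes _ = cong (_+_ 1ℤ) (count-sumList P? xs)
... | no _  = trans (count-sumList P? xs) (sym (+-identityˡ _))

sumList-tabulate : ∀ {a} {A : Set a} {n} (h : Fin n → A) (g : A → ℤ) → sumList (tabulate h) g ≡ sumFin (λ i → g (h i))
sumList-tabulate {n = zero}  h g = refl
sumList-tabulate {n = suc n} h g = cong (_+_ (g (h zero))) (sumList-tabulate (λ i → h (suc i)) g)

sumList-++ : ∀ {a} {A : Set a} (xs ys : List A) (g : A → ℤ) → sumList (xs ++ ys) g ≡ sumList xs g + sumList ys g
sumList-++ []       ys g = sym (+-identityˡ _)
sumList-++ (x ∷ xs) ys g = trans (cong (_+_ (g x)) (sumList-++ xs ys g)) (sym (+-assoc (g x) _ _))

sumList-map : ∀ {a b} {A : Set a} {B : Set b} (f : A → B) (xs : List A) (g : B → ℤ) →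
  sumList (map f xs) g ≡ sumList xs (λ x → g (f x))
sumList-map f []       g = refl
sumList-map f (x ∷ xs) g = cong (_+_ (g (f x))) (sumList-map f xs g)

sumList-cartesian : ∀ {a b} {A : Set a} {B : Set b} (xs : List A) (ys : List B) (g : A × B → ℤ) →
  sumList (cartesianProduct xs ys) g ≡ sumList xs (λ x → sumList ys (λ y → g (x , y)))
sumList-cartesian []       ys g = refl
sumList-cartesian (x ∷ xs) ys g =
  trans (sumList-++ (map (x ,_) ys) _ g) (cong₂ _+_ (sumList-map (x ,_) ys g) (sumList-cartesian xs ys g))

count-Fin : ∀ {n p} {P : Pred (Fin n) p} (P? : Decidable P) →
  + length (filter P? (allFin n)) ≡ sumFin (λ a → 𝟙 (P? a))
count-Fin {n} P? = trans (count-sumList P? (allFin n)) (sumList-tabulate (λ i → i) (λ a → 𝟙 (P? a)))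

count-Fin² : ∀ {n m p} {P : Pred (Fin n × Fin m) p} (P? : Decidable P) →
  + length (filter P? (cartesianProduct (allFin n) (allFin m))) ≡ sumFin (λ a → sumFin (λ b → 𝟙 (P? (a , b))))
count-Fin² {n} {m} P? =
  trans (count-sumList P? (cartesianProduct (allFin n) (allFin m)))
  (trans (sumList-cartesian (allFin n) (allFin m) (λ p → 𝟙 (P? p)))
  (trans (sumList-tabulate (λ i → i) (λ a → sumList (allFin m) (λ b → 𝟙 (P? (a , b)))))
         (Σ-cong (sumFin-linear {n}) (λ a → sumList-tabulate (λ i → i) (λ b → 𝟙 (P? (a , b)))))))

Prefix Suffix : ∀ {k} → Word k → Word k → Set
Prefix z x = ∃ λ t → z ++ t ≡ x
Suffix z x = ∃ λ s → s ++ z ≡ x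

module _ {k : ℕ} where

  levi : ∀ (a b c d : Word k) → a ++ b ≡ c ++ d →
    (∃ λ e → c ≡ a ++ e × b ≡ e ++ d) ⊎ (∃ λ e → a ≡ c ++ e × d ≡ e ++ b)
  levi []      b c       d eq = inj₁ (c , refl , eq)
  levi (x ∷ a) b []      d eq = inj₂ (x ∷ a , refl , sym eq)
  levi (x ∷ a) b (y ∷ c) d eq with ∷-injective eq
  ... | refl , eq′ with levi a b c d eq′
  ... | inj₁ (e , p , q) = inj₁ (e , cong (x ∷_) p , q)
  ... | inj₂ (e , p , q) = inj₂ (e , cong (x ∷_) p , q)

  prefixes-comparable : ∀ x u t → Prefix x (u ++ t) → Prefix x u ⊎ Prefix u x
  prefixes-comparable x u t (e , eq) with levi x e u t eq
  ... | inj₁ (e′ , p , _) = inj₁ (e′ , sym p)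
  ... | inj₂ (e′ , p , _) = inj₂ (e′ , sym p)

  suffixes-comparable : ∀ x s w → Suffix x (s ++ w) → Suffix x w ⊎ Suffix w x
  suffixes-comparable x s w (e , eq) with levi e x s w eq
  ... | inj₁ (e′ , _ , q) = inj₂ (e′ , sym q)
  ... | inj₂ (e′ , _ , q) = inj₁ (e′ , sym q)

  extension-longer : ∀ (e u : Word k) → length (e ++ u) ≡ length u → e ≡ []
  extension-longer []      u _ = refl
  extension-longer (a ∷ e) u h = ⊥-elim (ℕₚ.<-irrefl (sym h) (s≤s (length-++-≤ʳ u {e})))

  extension-not-longer : ∀ (u t : Word k) → length (u ++ t) ≤ length u → t ≡ []
  extension-not-longer []      []      _       = refl
  extension-not-longer []      (_ ∷ _) ()
  extension-not-longer (a ∷ u) t       (s≤s h) = extension-not-longer u t h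

  cancel-equal-length : ∀ (a u b u′ : Word k) → a ++ u ≡ b ++ u′ → length u ≡ length u′ → a ≡ b
  cancel-equal-length a u b u′ eq |u|≡|u′| with levi a u b u′ eq
  ... | inj₁ (e , p , q) with extension-longer e u′ (trans (cong length (sym q)) |u|≡|u′|)
  ...   | refl = sym (trans p (++-identityʳ a))
  cancel-equal-length a u b u′ eq |u|≡|u′| | inj₂ (e , p , q) with extension-longer e u (trans (cong length (sym q)) (sym |u|≡|u′|))
  ...   | refl = trans p (++-identityʳ b)

  prefix? : (z x : Word k) → Dec (Prefix z x)
  prefix? []      x       = yes (x , refl)
  prefix? (c ∷ z) []      = no λ { (t , ()) }
  prefix? (c ∷ z) (d ∷ x) with c Finₚ.≟ d | prefix? z x
  ... | yes refl | yes (t , e) = yes (t , cong (c ∷_) e)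
  ... | yes refl | no ¬p       = no λ { (t , e) → ¬p (t , proj₂ (∷-injective e)) }
  ... | no c≢d   | _           = no λ { (t , e) → c≢d (proj₁ (∷-injective e)) }

  suffix? : (z x : Word k) → Dec (Suffix z x)
  suffix? z x with z ≟W x
  ... | yes e = yes ([] , e)
  suffix? z []      | no z≢x = no λ { ([] , e) → z≢x e ; (_ ∷ _ , ()) }
  suffix? z (d ∷ x) | no z≢x with suffix? z x
  ... | yes (s , e) = yes (d ∷ s , cong (d ∷_) e)
  ... | no ¬p       = no λ { ([] , e) → z≢x e ; (c ∷ s , e) → ¬p (s , proj₂ (∷-injective e)) }

ProperSuffix ProperPrefix : ∀ {k} → Word k → Word k → Set
ProperSuffix p x = ∃₂ λ c s → (c ∷ s) ++ p ≡ x
ProperPrefix q x = ∃₂ λ c t → q ++ (c ∷ t) ≡ x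

module _ {k : ℕ} where

  properSuffix? : (p x : Word k) → Dec (ProperSuffix p x)
  properSuffix? p []      = no λ { (c , s , ()) }
  properSuffix? p (d ∷ x) = map′ (λ { (s , e) → d , s , cong (d ∷_) e })
                                 (λ { (c , s , e) → s , proj₂ (∷-injective e) }) (suffix? p x)

  properPrefix? : (q x : Word k) → Dec (ProperPrefix q x)
  properPrefix? []      []      = no λ { (c , t , ()) }
  properPrefix? []      (d ∷ x) = yes (d , x , refl)
  properPrefix? (a ∷ q) []      = no λ { (c , t , ()) }
  properPrefix? (a ∷ q) (d ∷ x) with a Finₚ.≟ d | properPrefix? q x
  ... | yes refl | yes (c , t , e) = yes (c , t , cong (a ∷_) e)
  ... | yes refl | no ¬p           = no λ { (c , t , e) → ¬p (c , t , proj₂ (∷-injective e)) }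
  ... | no a≢d   | _               = no λ { (c , t , e) → a≢d (proj₁ (∷-injective e)) }

  prefix-of-init : ∀ (x : Word k) d t q b → x ++ (d ∷ t) ≡ q ++ [ b ] → Prefix x q
  prefix-of-init x d t q b eq with levi x (d ∷ t) q [ b ] eq
  ... | inj₁ (e , q≡xe , _) = e , sym q≡xe
  ... | inj₂ ([] , x≡q , _) = [] , trans (++-identityʳ x) (trans x≡q (++-identityʳ q))
  ... | inj₂ (c ∷ e , _ , b≡ced∷t) with ++-conicalʳ e (d ∷ t) (sym (proj₂ (∷-injective b≡ced∷t)))
  ...   | ()

insert : ∀ {k} → WordSet k → Word k → WordSet k
insert X z y = X y ⊎ y ≡ z

module _ {k : ℕ} (X : WordSet k) (bifix : BifixCode X) (z : Word k) (z≢ε : z ≢ [])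
  (no-suffix   : ∀ x → X x → ¬ Suffix x z) (not-suffix : ∀ x → X x → ¬ Suffix z x)
  (no-prefix   : ∀ x → X x → ¬ Prefix x z) (not-prefix : ∀ x → X x → ¬ Prefix z x) where

  adjoin-bifix : BifixCode (insert X z)
  adjoin-bifix = nonempty , prefix-code , suffix-code
    where
    nonempty : ∀ x → insert X z x → x ≢ []
    nonempty x (inj₁ x∈X) = proj₁ bifix x x∈X
    nonempty x (inj₂ refl) = z≢ε
    prefix-code : ∀ x y c → insert X z x → insert X z y → c ≢ [] → x ++ c ≢ y
    prefix-code x y c (inj₁ x∈X) (inj₁ y∈X) c≢ε   = proj₁ (proj₂ bifix) x y c x∈X y∈X c≢ε
    prefix-code x y c (inj₁ x∈X) (inj₂ refl) _ e  = no-prefix x x∈X (c , e)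
    prefix-code x y c (inj₂ refl) (inj₁ y∈X) _ e  = not-prefix y y∈X (c , e)
    prefix-code x y c (inj₂ refl) (inj₂ refl) c≢ε e = c≢ε (++-identityʳ-unique z (sym e))
    suffix-code : ∀ x y c → insert X z x → insert X z y → c ≢ [] → c ++ x ≢ y
    suffix-code x y c (inj₁ x∈X) (inj₁ y∈X) c≢ε   = proj₂ (proj₂ bifix) x y c x∈X y∈X c≢ε
    suffix-code x y c (inj₁ x∈X) (inj₂ refl) _ e  = no-suffix x x∈X (c , e)
    suffix-code x y c (inj₂ refl) (inj₁ y∈X) _ e  = not-suffix y y∈X (c , e)
    suffix-code x y c (inj₂ refl) (inj₂ refl) c≢ε e = c≢ε (++-identityˡ-unique c (sym e))

record MaximalBifixCode {k : ℕ} (S X : WordSet k) : Set₁ where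
  field
    factorial : Factorial S
    recurrent : ∀ u w → S u → S w → ∃ λ v → S v × S (u ++ v ++ w)
    bifix     : BifixCode X
    X⊆S       : X ⊆ S
    maximal   : ∀ (Y : WordSet k) → BifixCode Y → Y ⊆ S → X ⊆ Y → Y ⊆ X
    search    : ∀ (P : Word k → Set) → (∀ x → Dec (P x)) → Dec (∃ λ x → X x × P x)
    bound     : ℕ
    bounded   : ∀ x → X x → length x ≤ bound
    x₀        : Word k
    x₀∈X      : X x₀

module SuffixCovering {k : ℕ} {S X : WordSet k} (H : MaximalBifixCode S X) where
  open MaximalBifixCode H

  HasSuffix IsSuffix HasPrefix IsPrefix : Word k → Set
  HasSuffix w = ∃ λ x → X x × Suffix x w
  IsSuffix  w = ∃ λ x → X x × Suffix w x
  HasPrefix w = ∃ λ x → X x × Prefix x w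
  IsPrefix  w = ∃ λ x → X x × Prefix w x

  hasSuffix? : ∀ w → Dec (HasSuffix w)
  hasSuffix? w = search (λ x → Suffix x w) (λ x → suffix? x w)
  isSuffix? : ∀ w → Dec (IsSuffix w)
  isSuffix? w = search (λ x → Suffix w x) (λ x → suffix? w x)
  hasPrefix? : ∀ w → Dec (HasPrefix w)
  hasPrefix? w = search (λ x → Prefix x w) (λ x → prefix? x w)
  isPrefix? : ∀ w → Dec (IsPrefix w)
  isPrefix? w = search (λ x → Prefix w x) (λ x → prefix? w x)

  SuffixFree PrefixFree : Word k → Set
  SuffixFree w = ¬ HasSuffix w × ¬ IsSuffix w
  PrefixFree w = ¬ HasPrefix w × ¬ IsPrefix w

  suffixFree-extend : ∀ w → SuffixFree w → ∀ s → SuffixFree (s ++ w)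
  suffixFree-extend w (no-suf , not-suf) s =
      (λ { (x , x∈X , sf) → either (λ x≤w → no-suf (x , x∈X , x≤w)) (λ w≤x → not-suf (x , x∈X , w≤x))
                              (suffixes-comparable x s w sf) })
    , (λ { (x , x∈X , e , eq) → not-suf (x , x∈X , e ++ s , trans (++-assoc e s w) eq) })

  prefixFree-extend : ∀ u → PrefixFree u → ∀ t → PrefixFree (u ++ t)
  prefixFree-extend u (no-pre , not-pre) t =
      (λ { (x , x∈X , pf) → either (λ x≤u → no-pre (x , x∈X , x≤u)) (λ u≤x → not-pre (x , x∈X , u≤x))
                              (prefixes-comparable x u t pf) })
    , (λ { (x , x∈X , e , eq) → not-pre (x , x∈X , t ++ e , trans (sym (++-assoc u t e)) eq) })

  -- A suffix-free and a prefix-free word of S cannot coexist: by recurrence u·v·w ∈ S,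
  -- which is free on both sides, so X ∪ {uvw} is a bifix code in S larger than X.
  not-both-free : ∀ w → S w → SuffixFree w → ∀ u → S u → PrefixFree u → ⊥
  not-both-free w w∈S w-free u u∈S u-free = proj₁ z-sfree (z , z∈X , [] , refl)
    where
    v = proj₁ (recurrent u w u∈S w∈S)
    z = u ++ v ++ w
    z-sfree : SuffixFree z
    z-sfree = subst SuffixFree (++-assoc u v w) (suffixFree-extend w w-free (u ++ v))
    z-pfree : PrefixFree z
    z-pfree = prefixFree-extend u u-free (v ++ w)
    z≢ε : z ≢ []
    z≢ε z≡ε = proj₂ z-pfree (x₀ , x₀∈X , x₀ , cong (_++ x₀) z≡ε)
    z∈X : X z
    z∈X = maximal (insert X z) (adjoin-bifix X bifix z z≢ε
            (λ x x∈X sf → proj₁ z-sfree (x , x∈X , sf)) (λ x x∈X sf → proj₂ z-sfree (x , x∈X , sf))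
            (λ x x∈X pf → proj₁ z-pfree (x , x∈X , pf)) (λ x x∈X pf → proj₂ z-pfree (x , x∈X , pf)))
          (λ { (inj₁ x∈X) → X⊆S x∈X ; (inj₂ refl) → proj₂ (proj₂ (recurrent u w u∈S w∈S)) })
          inj₁ (inj₂ refl)

  -- When no word of S is prefix-free, every word of S of length ≥ bound has a prefix in X
  -- (it cannot be a proper prefix of a word of X, which is at most that long).
  long-words-have-prefix : (∀ u → S u → ¬ PrefixFree u) → ∀ u → S u → bound ≤ length u → HasPrefix u
  long-words-have-prefix none-free u u∈S long with hasPrefix? u
  ... | yes has = has
  ... | no ¬has with isPrefix? u
  ...   | no ¬is = ⊥-elim (none-free u u∈S (¬has , ¬is))
  ...   | yes (x , x∈X , t , u++t≡x) = ⊥-elim (¬has (x , x∈X , [] , trans (++-identityʳ x) (sym u≡x)))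
    where
    t≡ε : t ≡ []
    t≡ε = extension-not-longer u t
            (ℕₚ.≤-trans (ℕₚ.≤-reflexive (cong length u++t≡x)) (ℕₚ.≤-trans (bounded x x∈X) long))
    u≡x : u ≡ x
    u≡x = trans (sym (++-identityʳ u)) (trans (cong (u ++_) (sym t≡ε)) u++t≡x)

  data X* : Word k → Set where
    ε*  : X* []
    _·_ : ∀ {β x} → X* β → X x → X* (β ++ x)

  prepend : ∀ {x β} → X x → X* β → X* (x ++ β)
  prepend {x} x∈X ε*                  = subst X* (sym (++-identityʳ x)) (ε* · x∈X)
  prepend {x} x∈X (_·_ {β} {y} β* y∈X) = subst X* (++-assoc x β y) (prepend x∈X β* · y∈X)

  Parse : Word k → Set
  Parse t = ∃₂ λ β u → X* β × β ++ u ≡ t × ¬ HasPrefix u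

  -- Code words are nonempty, so splitting one off shortens a word; this makes `parse` terminate.
  code-word-longer : ∀ {x} t → X x → length t < length (x ++ t)
  code-word-longer {[]}    t x∈X = ⊥-elim (proj₁ bifix [] x∈X refl)
  code-word-longer {c ∷ x} t _   = s≤s (length-++-≤ʳ t {x})

  parse : ∀ n t → length t ≤ n → Parse t
  parse n t |t|≤n with hasPrefix? t
  ... | no ¬has = [] , t , ε* , refl , ¬has
  parse zero t |t|≤n | yes (x , x∈X , t′ , x++t′≡t) =
    ⊥-elim (ℕₚ.n≮0 (ℕₚ.<-≤-trans (code-word-longer t′ x∈X) (ℕₚ.≤-trans (ℕₚ.≤-reflexive (cong length x++t′≡t)) |t|≤n)))
  parse (suc n) t |t|≤n | yes (x , x∈X , t′ , x++t′≡t)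
    with parse n t′ (ℕₚ.≤-pred (ℕₚ.<-≤-trans (code-word-longer t′ x∈X)
                                  (ℕₚ.≤-trans (ℕₚ.≤-reflexive (cong length x++t′≡t)) |t|≤n)))
  ... | β , u , β* , β++u≡t′ , ¬has =
    x ++ β , u , prepend x∈X β* , trans (++-assoc x β u) (trans (cong (x ++_) β++u≡t′) x++t′≡t) , ¬has

  -- Since X is a suffix code, r·β = β′ with β, β′ ∈ X* and r ≠ ε forces r to have a suffix in X:
  -- peel equal code words off the right end until β is exhausted.
  peel : ∀ r {β β′} → r ≢ [] → X* β → X* β′ → r ++ β ≡ β′ → HasSuffix r
  peel r r≢ε ε* ε* eq = ⊥-elim (r≢ε (trans (sym (++-identityʳ r)) eq))
  peel r r≢ε ε* (_·_ {β″} {y} _ y∈X) eq = y , y∈X , β″ , trans (sym eq) (++-identityʳ r)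
  peel r r≢ε (_ · _) ε* eq = ⊥-elim (r≢ε (++-conicalˡ r _ eq))
  peel r r≢ε (_·_ {β₀} {x} β* x∈X) (_·_ {β″} {y} β′* y∈X) eq
    with levi (r ++ β₀) x β″ y (trans (++-assoc r β₀ x) eq)
  ... | inj₁ ([] , p , _) = peel r r≢ε β* β′* (trans (sym (++-identityʳ (r ++ β₀))) (sym p))
  ... | inj₁ (c ∷ e , _ , q) = ⊥-elim (proj₂ (proj₂ bifix) y x (c ∷ e) y∈X x∈X (λ ()) (sym q))
  ... | inj₂ ([] , p , _) = peel r r≢ε β* β′* (trans p (++-identityʳ β″))
  ... | inj₂ (c ∷ e , _ , q) = ⊥-elim (proj₂ (proj₂ bifix) x y (c ∷ e) x∈X y∈X (λ ()) (sym q))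

  -- Given a suffix-free w ∈ S, recurrence yields words
  -- t₀ = ε, t_{n+1} = v_n·w·t_n with w·t_n ∈ S.  As then no word of S is prefix-free,
  -- every t_n parses as β_n·u_n with β_n ∈ X* and |u_n| < bound.  Two indices i < j
  -- share |u_i| = |u_j|, and t_j = s·w·t_i then gives s·w·β_i = β_j, so that the
  -- suffix-free word s·w would have a suffix in X.
  module SuffixFreeWord (w : Word k) (w∈S : S w) (w-free : SuffixFree w) where

    extend : Σ (Word k) (λ t → S (w ++ t)) → Σ (Word k) (λ t → S (w ++ t))
    extend (t , wt∈S) = proj₁ r ++ w ++ t , proj₂ (proj₂ r)
      where r = recurrent w (w ++ t) w∈S wt∈S

    chain : ℕ → Σ (Word k) (λ t → S (w ++ t))
    chain zero    = [] , subst S (sym (++-identityʳ w)) w∈S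
    chain (suc n) = extend (chain n)

    t : ℕ → Word k
    t n = proj₁ (chain n)

    v : ℕ → Word k
    v n = proj₁ (recurrent w (w ++ t n) w∈S (proj₂ (chain n)))

    t∈S : ∀ n → S (t n)
    t∈S n = factorial w (t n) [] (subst S (cong (w ++_) (sym (++-identityʳ (t n)))) (proj₂ (chain n)))

    gap : ∀ {i j} → i < j → ∃ λ s → t j ≡ s ++ w ++ t i
    gap {i} {suc j} (s≤s i≤j) with ℕₚ.m≤n⇒m<n∨m≡n i≤j
    ... | inj₂ refl = v j , refl
    ... | inj₁ i<j with gap i<j
    ...   | s , tj≡swti = v j ++ w ++ s ,
            trans (cong (λ z → v j ++ w ++ z) tj≡swti)
                  (sym (trans (++-assoc (v j) (w ++ s) (w ++ t i)) (cong (v j ++_) (++-assoc w s (w ++ t i)))))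

    parsed : ∀ n → Parse (t n)
    parsed n = parse (length (t n)) (t n) ℕₚ.≤-refl

    tail-length : ℕ → ℕ
    tail-length n = length (proj₁ (proj₂ (parsed n)))

    short-tail : ∀ n → tail-length n < bound
    short-tail n with parsed n
    ... | β , u , _ , β++u≡t , ¬has with bound ℕₚ.≤? length u
    ...   | no short = ℕₚ.≰⇒> short
    ...   | yes long = ⊥-elim (¬has (long-words-have-prefix none-prefix-free u u∈S long))
      where
      none-prefix-free : ∀ u → S u → ¬ PrefixFree u
      none-prefix-free u u∈S = not-both-free w w∈S w-free u u∈S
      u∈S : S u
      u∈S = factorial β u [] (subst S (trans (sym β++u≡t) (cong (β ++_) (sym (++-identityʳ u)))) (t∈S n))

    distinct-tails : ∀ {i j} → i < j → tail-length i ≢ tail-length j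
    distinct-tails {i} {j} i<j same with gap i<j | parsed i | parsed j
    ... | s , tj≡swti | β , u , β* , β++u≡ti , _ | β′ , u′ , β′* , β′++u′≡tj , _ =
      proj₁ (suffixFree-extend w w-free s) (peel (s ++ w) sw≢ε β* β′* (cancel-equal-length ((s ++ w) ++ β) u β′ u′ split same))
      where
      sw≢ε : s ++ w ≢ []
      sw≢ε sw≡ε = proj₂ w-free (x₀ , x₀∈X , x₀ , trans (cong (x₀ ++_) (++-conicalʳ s w sw≡ε)) (++-identityʳ x₀))
      split : ((s ++ w) ++ β) ++ u ≡ β′ ++ u′
      split = trans (++-assoc (s ++ w) β u) (trans (cong ((s ++ w) ++_) β++u≡ti)
                (trans (++-assoc s w (t i)) (trans (sym tj≡swti) (sym β′++u′≡tj))))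

    impossible : ⊥
    impossible with Finₚ.pigeonhole (ℕₚ.n<1+n bound) (λ j → fromℕ< (short-tail (toℕ j)))
    ... | i , j , i<j , same = distinct-tails i<j
      (trans (sym (Finₚ.toℕ-fromℕ< (short-tail (toℕ i)))) (trans (cong toℕ same) (Finₚ.toℕ-fromℕ< (short-tail (toℕ j)))))

  suffix-covering : ∀ w → S w → HasSuffix w ⊎ IsSuffix w
  suffix-covering w w∈S with hasSuffix? w | isSuffix? w
  ... | yes has | _      = inj₁ has
  ... | no _    | yes is = inj₂ is
  ... | no ¬has | no ¬is = ⊥-elim (SuffixFreeWord.impossible w w∈S (¬has , ¬is))

module _ {k : ℕ} where

  mirror : WordSet k → WordSet k
  mirror Z u = Z (reverse u)

  reverse-++³ : ∀ (u v w : Word k) → reverse (u ++ v ++ w) ≡ reverse w ++ reverse v ++ reverse u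
  reverse-++³ u v w = trans (reverse-++ u (v ++ w)) (trans (cong (_++ reverse u) (reverse-++ v w))
                                                        (++-assoc (reverse w) (reverse v) (reverse u)))

  reverse-empty : ∀ (x : Word k) → reverse x ≡ [] → x ≡ []
  reverse-empty x e = trans (sym (reverse-involutive x)) (cong reverse e)

  mirror-bifix : ∀ (Z : WordSet k) → BifixCode Z → BifixCode (mirror Z)
  mirror-bifix Z (nonempty , prefix-code , suffix-code) =
      (λ x x∈Z e → nonempty (reverse x) x∈Z (cong reverse e))
    , (λ x y c x∈Z y∈Z c≢ε e → suffix-code (reverse x) (reverse y) (reverse c) x∈Z y∈Z
          (λ e′ → c≢ε (reverse-empty c e′)) (trans (sym (reverse-++ x c)) (cong reverse e)))
    , (λ x y c x∈Z y∈Z c≢ε e → prefix-code (reverse x) (reverse y) (reverse c) x∈Z y∈Z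
          (λ e′ → c≢ε (reverse-empty c e′)) (trans (sym (reverse-++ c x)) (cong reverse e)))

  into-mirror : ∀ (Z : WordSet k) {u} → Z u → mirror Z (reverse u)
  into-mirror Z {u} = subst Z (sym (reverse-involutive u))

  mirrored : ∀ {S X : WordSet k} → MaximalBifixCode S X → MaximalBifixCode (mirror S) (mirror X)
  mirrored {S} {X} H = record
    { factorial = λ u v w h → factorial (reverse w) (reverse v) (reverse u) (subst S (reverse-++³ u v w) h)
    ; recurrent = mirror-recurrent
    ; bifix     = mirror-bifix X bifix
    ; X⊆S       = X⊆S
    ; maximal   = λ Y bifix-Y Y⊆S X⊆Y {z} z∈Y →
        maximal (mirror Y) (mirror-bifix Y bifix-Y) (λ {z} z∈Y′ → subst S (reverse-involutive z) (Y⊆S z∈Y′))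
                (λ {z} z∈X → X⊆Y (into-mirror X z∈X)) (subst Y (sym (reverse-involutive z)) z∈Y)
    ; search    = λ P P? → map′ (λ { (x , x∈X , p) → reverse x , into-mirror X x∈X , p })
                               (λ { (x , x∈X , p) → reverse x , x∈X , subst P (sym (reverse-involutive x)) p })
                               (search (λ x → P (reverse x)) (λ x → P? (reverse x)))
    ; bound     = bound
    ; bounded   = λ x x∈X → subst (_≤ bound) (length-reverse x) (bounded (reverse x) x∈X)
    ; x₀        = reverse x₀
    ; x₀∈X      = into-mirror X x₀∈X
    }
    where
    open MaximalBifixCode H
    mirror-recurrent : ∀ u w → mirror S u → mirror S w → ∃ λ v → mirror S v × mirror S (u ++ v ++ w)
    mirror-recurrent u w u∈S w∈S with recurrent (reverse w) (reverse u) w∈S u∈S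
    ... | v , v∈S , z∈S = reverse v , into-mirror S v∈S ,
          subst S (sym (trans (reverse-++³ u (reverse v) w) (cong (λ z → reverse w ++ z ++ reverse u) (reverse-involutive v)))) z∈S

module Covering {k : ℕ} {S X : WordSet k} (H : MaximalBifixCode S X) where
  open SuffixCovering H public using (HasPrefix; IsPrefix; suffix-covering)

  prefix-covering : ∀ w → S w → HasPrefix w ⊎ IsPrefix w
  prefix-covering w w∈S with SuffixCovering.suffix-covering (mirrored H) (reverse w) (into-mirror S w∈S)
  ... | inj₁ (x , x∈X , s , s++x≡w̃) =
    inj₁ (reverse x , x∈X , reverse s , trans (sym (reverse-++ s x)) (trans (cong reverse s++x≡w̃) (reverse-involutive w)))
  ... | inj₂ (x , x∈X , s , s++w̃≡x) =
    inj₂ (reverse x , x∈X , reverse s ,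
          trans (cong (_++ reverse s) (sym (reverse-involutive w))) (trans (sym (reverse-++ s (reverse w))) (cong reverse s++w̃≡x)))

*-distribˡ-minus : ∀ c a b → c * (a - b) ≡ c * a - c * b
*-distribˡ-minus = solve-∀

rearrange : ∀ a b c d → a + b ≡ c + d → b - d ≡ c - a
rearrange a b c d h = begin
  b - d           ≡⟨ expand a b d ⟩
  (a + b) - a - d ≡⟨ cong (λ z → z - a - d) h ⟩
  (c + d) - a - d ≡⟨ contract c d a ⟩
  c - a           ∎
  where
  expand : ∀ a b d → b - d ≡ (a + b) - a - d
  expand = solve-∀
  contract : ∀ c d a → (c + d) - a - d ≡ c - a
  contract = solve-∀

reorder : ∀ a b c d → a - b - c + d ≡ a - c - b + d
reorder = solve-∀

replace-constant : ∀ x y c d → x + c ≡ y + c → x + d ≡ y + d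
replace-constant x y c d h = trans (shift x c d) (trans (cong (λ z → z - c + d) h) (sym (shift y c d)))
  where
  shift : ∀ x c d → x + d ≡ x + c - c + d
  shift = solve-∀

module ExtensionCounts {k : ℕ} (s : Word k → ℤ) where

  ℓ r e t : Word k → ℤ
  ℓ u = sumFin (λ a → s (a ∷ u))
  r u = sumFin (λ b → s (u ++ [ b ]))
  e u = sumFin (λ a → sumFin (λ b → s (a ∷ u ++ [ b ])))
  t u = e u - ℓ u - r u + s u

-- The same counts with letters replaced by the words of a code (weighted by ξ,
-- supported on words of length ≤ N): ℓX(y) = Σ_z ξ(z) s(zy), and so on.
module CodeExtensionCounts {k : ℕ} (N : ℕ) (s ξ : Word k → ℤ) where

  W : (Word k → ℤ) → ℤ
  W = sumWords N

  ℓX rX eX : Word k → ℤ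
  ℓX y = W (λ z → ξ z * s (z ++ y))
  rX y = W (λ z → ξ z * s (y ++ z))
  eX y = W (λ z → ξ z * W (λ z′ → ξ z′ * s (z ++ y ++ z′)))

-- Read s as the indicator of S, ξ of a code X, ι of the
-- proper suffixes and κ of the proper prefixes of X, all supported on words of
-- length ≤ N.  The two step hypotheses say that going one letter up the suffix
-- tree (prefix tree) inside S either stays a proper suffix (prefix) or reaches a
-- code word, never both.
module TreeIdentity {k : ℕ} (N : ℕ) (s ξ ι κ : Word k → ℤ)
  (ξ-ε : ξ [] ≡ 0ℤ) (ι-ε : ι [] ≡ 1ℤ) (κ-ε : κ [] ≡ 1ℤ)
  (ξ-long : ∀ z → N < length z → ξ z ≡ 0ℤ)
  (ι-long : ∀ z → N < length z → ι z ≡ 0ℤ)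
  (κ-long : ∀ z → N < length z → κ z ≡ 0ℤ)
  (left-step : ∀ a p y → ι p * s (a ∷ p ++ y) ≡ (ξ (a ∷ p) + ι (a ∷ p)) * s (a ∷ p ++ y))
  (right-step : ∀ b q y → κ q * s ((y ++ q) ++ [ b ]) ≡ (ξ (q ++ [ b ]) + κ (q ++ [ b ])) * s (y ++ q ++ [ b ]))
  where

  open ExtensionCounts s public
  open CodeExtensionCounts N s ξ public

  W-lin : Linear W
  W-lin = sumWords-linear N

  F-lin : Linear (sumFin {k})
  F-lin = sumFin-linear

  left-tree : ∀ y → ℓX y - s y ≡ W (λ p → ι p * (ℓ (p ++ y) - s (p ++ y)))
  left-tree y = sym (begin
      W (λ p → ι p * (ℓ (p ++ y) - s (p ++ y)))
    ≡⟨ Σ-cong W-lin (λ p → *-distribˡ-minus (ι p) _ _) ⟩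
      W (λ p → ι p * ℓ (p ++ y) - ι p * s (p ++ y))
    ≡⟨ Σ-- W-lin _ _ ⟩
      W (λ p → ι p * ℓ (p ++ y)) - B
    ≡⟨ cong (_- B) children ⟩
      sumFin (λ a → W (λ p → H (a ∷ p))) - B
    ≡⟨ rearrange (H []) _ (ℓX y) B whole ⟩
      ℓX y - H []
    ≡⟨ cong (_-_ (ℓX y)) H-ε ⟩
      ℓX y - s y ∎)
    where
    H : Word k → ℤ
    H z = (ξ z + ι z) * s (z ++ y)
    B : ℤ
    B = W (λ z → ι z * s (z ++ y))
    H-ε : H [] ≡ s y
    H-ε = trans (cong (λ c → c * s y) (trans (cong₂ _+_ ξ-ε ι-ε) (+-identityˡ 1ℤ))) (*-identityˡ (s y))
    H-long : ∀ z → N < length z → H z ≡ 0ℤ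
    H-long z lt = trans (cong (λ c → c * s (z ++ y)) (cong₂ _+_ (ξ-long z lt) (ι-long z lt))) (*-zeroˡ (s (z ++ y)))
    children : W (λ p → ι p * ℓ (p ++ y)) ≡ sumFin (λ a → W (λ p → H (a ∷ p)))
    children = begin
      W (λ p → ι p * ℓ (p ++ y))                     ≡⟨ Σ-cong W-lin (λ p → sym (Σ-* F-lin (ι p) _)) ⟩
      W (λ p → sumFin (λ a → ι p * s (a ∷ p ++ y)))  ≡⟨ sumWords-interchange N sumFin F-lin _ ⟩
      sumFin (λ a → W (λ p → ι p * s (a ∷ p ++ y)))  ≡⟨ Σ-cong F-lin (λ a → Σ-cong W-lin (λ p → left-step a p y)) ⟩
      sumFin (λ a → W (λ p → H (a ∷ p)))             ∎
    whole : H [] + sumFin (λ a → W (λ p → H (a ∷ p))) ≡ ℓX y + B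
    whole = begin
      H [] + sumFin (λ a → W (λ p → H (a ∷ p)))      ≡⟨ sumWords-extend N H H-long ⟩
      W H                                             ≡⟨ Σ-cong W-lin (λ z → *-distribʳ-+ (s (z ++ y)) (ξ z) (ι z)) ⟩
      W (λ z → ξ z * s (z ++ y) + ι z * s (z ++ y))  ≡⟨ Σ-+ W-lin _ _ ⟩
      ℓX y + B                                        ∎

  right-tree : ∀ y → rX y - s y ≡ W (λ q → κ q * (r (y ++ q) - s (y ++ q)))
  right-tree y = sym (begin
      W (λ q → κ q * (r (y ++ q) - s (y ++ q)))
    ≡⟨ Σ-cong W-lin (λ q → *-distribˡ-minus (κ q) _ _) ⟩
      W (λ q → κ q * r (y ++ q) - κ q * s (y ++ q))
    ≡⟨ Σ-- W-lin _ _ ⟩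
      W (λ q → κ q * r (y ++ q)) - B
    ≡⟨ cong (_- B) children ⟩
      sumFin (λ b → sumWordsʳ N (λ q → H (q ++ [ b ]))) - B
    ≡⟨ rearrange (H []) _ (rX y) B whole ⟩
      rX y - H []
    ≡⟨ cong (_-_ (rX y)) H-ε ⟩
      rX y - s y ∎)
    where
    H : Word k → ℤ
    H z = (ξ z + κ z) * s (y ++ z)
    B : ℤ
    B = W (λ z → κ z * s (y ++ z))
    H-ε : H [] ≡ s y
    H-ε = trans (cong₂ _*_ (trans (cong₂ _+_ ξ-ε κ-ε) (+-identityˡ 1ℤ)) (cong s (++-identityʳ y))) (*-identityˡ (s y))
    H-long : ∀ z → N < length z → H z ≡ 0ℤ
    H-long z lt = trans (cong (λ c → c * s (y ++ z)) (cong₂ _+_ (ξ-long z lt) (κ-long z lt))) (*-zeroˡ (s (y ++ z)))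
    children : W (λ q → κ q * r (y ++ q)) ≡ sumFin (λ b → sumWordsʳ N (λ q → H (q ++ [ b ])))
    children = begin
      W (λ q → κ q * r (y ++ q))                                ≡⟨ Σ-cong W-lin (λ q → sym (Σ-* F-lin (κ q) _)) ⟩
      W (λ q → sumFin (λ b → κ q * s ((y ++ q) ++ [ b ])))     ≡⟨ sumWords-interchange N sumFin F-lin _ ⟩
      sumFin (λ b → W (λ q → κ q * s ((y ++ q) ++ [ b ])))     ≡⟨ Σ-cong F-lin (λ b → sym (sumWordsʳ≡sumWords N _)) ⟩
      sumFin (λ b → sumWordsʳ N (λ q → κ q * s ((y ++ q) ++ [ b ])))
        ≡⟨ Σ-cong F-lin (λ b → Σ-cong (sumWordsʳ-linear N) (λ q → right-step b q y)) ⟩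
      sumFin (λ b → sumWordsʳ N (λ q → H (q ++ [ b ])))        ∎
    whole : H [] + sumFin (λ b → sumWordsʳ N (λ q → H (q ++ [ b ]))) ≡ rX y + B
    whole = begin
      sumWordsʳ (suc N) H                            ≡⟨ sumWordsʳ≡sumWords (suc N) H ⟩
      sumWords (suc N) H                             ≡⟨ sumWords-extend N H H-long ⟩
      W H                                             ≡⟨ Σ-cong W-lin (λ z → *-distribʳ-+ (s (y ++ z)) (ξ z) (κ z)) ⟩
      W (λ z → ξ z * s (y ++ z) + κ z * s (y ++ z))  ≡⟨ Σ-+ W-lin _ _ ⟩
      rX y + B                                        ∎

  code-left-difference : ∀ u → W (λ z → ξ z * (ℓ (u ++ z) - s (u ++ z))) ≡ sumFin (λ a → rX (a ∷ u)) - rX u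
  code-left-difference u = begin
      W (λ z → ξ z * (ℓ (u ++ z) - s (u ++ z)))
    ≡⟨ Σ-cong W-lin (λ z → *-distribˡ-minus (ξ z) _ _) ⟩
      W (λ z → ξ z * ℓ (u ++ z) - ξ z * s (u ++ z))
    ≡⟨ Σ-- W-lin _ _ ⟩
      W (λ z → ξ z * ℓ (u ++ z)) - rX u
    ≡⟨ cong (_- rX u) (trans (Σ-cong W-lin (λ z → sym (Σ-* F-lin (ξ z) _))) (sumWords-interchange N sumFin F-lin _)) ⟩
      sumFin (λ a → rX (a ∷ u)) - rX u ∎

  left-extension : ∀ u → sumFin (λ a → rX (a ∷ u)) - rX u ≡ (ℓ u - s u) + W (λ q → κ q * t (u ++ q))
  left-extension u = begin
      sumFin (λ a → rX (a ∷ u)) - rX u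
    ≡⟨ cong₂ _-_ extended (rX-expand u) ⟩
      (ℓ u + Δe) - (s u + Δr)
    ≡⟨ regroup (ℓ u) (s u) Δe Δr ⟩
      (ℓ u - s u) + (Δe - Δr)
    ≡⟨ cong (_+_ (ℓ u - s u)) (trans (sym (Σ-- W-lin _ _)) (Σ-cong W-lin (λ q → combine (κ q) (e (u ++ q)) (ℓ (u ++ q)) (r (u ++ q)) (s (u ++ q))))) ⟩
      (ℓ u - s u) + W (λ q → κ q * t (u ++ q)) ∎
    where
    Δe Δr : ℤ
    Δe = W (λ q → κ q * (e (u ++ q) - ℓ (u ++ q)))
    Δr = W (λ q → κ q * (r (u ++ q) - s (u ++ q)))
    rX-expand : ∀ v → rX v ≡ s v + W (λ q → κ q * (r (v ++ q) - s (v ++ q)))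
    rX-expand v = trans (split (rX v) (s v)) (cong (_+_ (s v)) (right-tree v))
      where
      split : ∀ a b → a ≡ b + (a - b)
      split = solve-∀
    extended : sumFin (λ a → rX (a ∷ u)) ≡ ℓ u + Δe
    extended = begin
        sumFin (λ a → rX (a ∷ u))
      ≡⟨ trans (Σ-cong F-lin (λ a → rX-expand (a ∷ u))) (Σ-+ F-lin _ _) ⟩
        ℓ u + sumFin (λ a → W (λ q → κ q * (r (a ∷ u ++ q) - s (a ∷ u ++ q))))
      ≡⟨ cong (_+_ (ℓ u)) (sumFin-interchange {k} W W-lin (λ a q → κ q * (r (a ∷ u ++ q) - s (a ∷ u ++ q)))) ⟩
        ℓ u + W (λ q → sumFin (λ a → κ q * (r (a ∷ u ++ q) - s (a ∷ u ++ q))))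
      ≡⟨ cong (_+_ (ℓ u)) (Σ-cong W-lin (λ q → trans (Σ-* F-lin (κ q) _) (cong (κ q *_) (Σ-- F-lin _ _)))) ⟩
        ℓ u + Δe ∎
    regroup : ∀ a b c d → (a + c) - (b + d) ≡ (a - b) + (c - d)
    regroup = solve-∀
    combine : ∀ j a b c d → j * (a - b) - j * (c - d) ≡ j * (a - b - c + d)
    combine = solve-∀

  W-swap : ∀ (f g : Word k → ℤ) (h : Word k → Word k → ℤ) →
    W (λ z → f z * W (λ z′ → g z′ * h z z′)) ≡ W (λ z′ → g z′ * W (λ z → f z * h z z′))
  W-swap f g h = begin
      W (λ z → f z * W (λ z′ → g z′ * h z z′))
    ≡⟨ Σ-cong W-lin (λ z → sym (Σ-* W-lin (f z) _)) ⟩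
      W (λ z → W (λ z′ → f z * (g z′ * h z z′)))
    ≡⟨ sumWords-interchange N W W-lin _ ⟩
      W (λ z′ → W (λ z → f z * (g z′ * h z z′)))
    ≡⟨ Σ-cong W-lin (λ z′ → trans (Σ-cong W-lin (λ z → x*[y*z]≡y*[x*z] (f z) (g z′) (h z z′))) (Σ-* W-lin (g z′) _)) ⟩
      W (λ z′ → g z′ * W (λ z → f z * h z z′)) ∎
    where
    x*[y*z]≡y*[x*z] : ∀ a b c → a * (b * c) ≡ b * (a * c)
    x*[y*z]≡y*[x*z] = solve-∀

  tree-identity : ∀ y → eX y - rX y - ℓX y + s y ≡ W (λ p → ι p * W (λ q → κ q * t ((p ++ y) ++ q)))
  tree-identity y = cancel (eX y - rX y) (ℓX y) (s y) _ (begin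
      eX y - rX y
    ≡⟨ cong (_- rX y) (W-swap ξ ξ (λ z z′ → s (z ++ y ++ z′))) ⟩
      W (λ z′ → ξ z′ * ℓX (y ++ z′)) - rX y
    ≡⟨ trans (sym (Σ-- W-lin _ _)) (Σ-cong W-lin (λ z′ → sym (*-distribˡ-minus (ξ z′) _ _))) ⟩
      W (λ z′ → ξ z′ * (ℓX (y ++ z′) - s (y ++ z′)))
    ≡⟨ Σ-cong W-lin (λ z′ → cong (ξ z′ *_) (left-tree (y ++ z′))) ⟩
      W (λ z′ → ξ z′ * W (λ p → ι p * (ℓ (p ++ y ++ z′) - s (p ++ y ++ z′))))
    ≡⟨ W-swap ξ ι (λ z′ p → ℓ (p ++ y ++ z′) - s (p ++ y ++ z′)) ⟩
      W (λ p → ι p * W (λ z′ → ξ z′ * (ℓ (p ++ y ++ z′) - s (p ++ y ++ z′))))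
    ≡⟨ Σ-cong W-lin (λ p → cong (ι p *_) (Σ-cong W-lin (λ z′ →
         cong (λ w → ξ z′ * (ℓ w - s w)) (sym (++-assoc p y z′))))) ⟩
      W (λ p → ι p * W (λ z′ → ξ z′ * (ℓ ((p ++ y) ++ z′) - s ((p ++ y) ++ z′))))
    ≡⟨ Σ-cong W-lin (λ p → cong (ι p *_) (trans (code-left-difference (p ++ y)) (left-extension (p ++ y)))) ⟩
      W (λ p → ι p * ((ℓ (p ++ y) - s (p ++ y)) + W (λ q → κ q * t ((p ++ y) ++ q))))
    ≡⟨ trans (Σ-cong W-lin (λ p → *-distribˡ-+ (ι p) _ _)) (Σ-+ W-lin _ _) ⟩
      W (λ p → ι p * (ℓ (p ++ y) - s (p ++ y))) + W (λ p → ι p * W (λ q → κ q * t ((p ++ y) ++ q)))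
    ≡⟨ cong (_+ W (λ p → ι p * W (λ q → κ q * t ((p ++ y) ++ q)))) (sym (left-tree y)) ⟩
      (ℓX y - s y) + W (λ p → ι p * W (λ q → κ q * t ((p ++ y) ++ q))) ∎)
    where
    cancel : ∀ a c d R → a ≡ (c - d) + R → a - c + d ≡ R
    cancel a c d R h = trans (cong (λ z → z - c + d) h) (identity c d R)
      where
      identity : ∀ c d R → (c - d) + R - c + d ≡ R
      identity = solve-∀

  -- When t vanishes on nonempty words, only the term p = q = ε can survive.
  module _ (t-vanish : ∀ u → u ≢ [] → t u ≡ 0ℤ) where

    nonempty-identity : ∀ y → y ≢ [] → eX y - rX y - ℓX y + s y ≡ 0ℤ
    nonempty-identity y y≢ε = trans (tree-identity y)
      (Σ-vanish W-lin (λ p → trans (cong (ι p *_) (Σ-vanish W-lin (λ q →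
         trans (cong (κ q *_) (t-vanish ((p ++ y) ++ q) (pyq≢ε p q))) (*-zeroʳ (κ q))))) (*-zeroʳ (ι p))))
      where
      pyq≢ε : ∀ p q → (p ++ y) ++ q ≢ []
      pyq≢ε p q e = y≢ε (++-conicalʳ p y (++-conicalˡ (p ++ y) q e))

    empty-identity : eX [] - rX [] - ℓX [] + s [] ≡ t []
    empty-identity = begin
        eX [] - rX [] - ℓX [] + s []
      ≡⟨ tree-identity [] ⟩
        W (λ p → ι p * W (λ q → κ q * t ((p ++ []) ++ q)))
      ≡⟨ sumWords-root N _ (λ a p → trans (cong (ι (a ∷ p) *_) (Σ-vanish W-lin (λ q →
           trans (cong (κ q *_) (t-vanish (((a ∷ p) ++ []) ++ q) (λ ()))) (*-zeroʳ (κ q))))) (*-zeroʳ (ι (a ∷ p)))) ⟩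
        ι [] * W (λ q → κ q * t q)
      ≡⟨ cong₂ _*_ ι-ε (sumWords-root N _ (λ a q → trans (cong (κ (a ∷ q) *_) (t-vanish (a ∷ q) (λ ()))) (*-zeroʳ (κ (a ∷ q))))) ⟩
        1ℤ * (κ [] * t [])
      ≡⟨ trans (*-identityˡ _) (trans (cong (_* t []) κ-ε) (*-identityˡ (t []))) ⟩
        t [] ∎

module CodeTrees {k : ℕ} {S X : WordSet k} (H : MaximalBifixCode S X) (S? : Decidable S) where
  open MaximalBifixCode H
  open Covering H

  X? : Decidable X
  X? z = map′ (λ { (x , x∈X , x≡z) → subst X x≡z x∈X }) (λ z∈X → z , z∈X , refl) (search (_≡ z) (_≟W z))

  Suffixes Prefixes : WordSet k
  Suffixes p = ∃ λ x → X x × ProperSuffix p x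
  Prefixes q = ∃ λ x → X x × ProperPrefix q x

  Suffixes? : Decidable Suffixes
  Suffixes? p = search (ProperSuffix p) (properSuffix? p)

  Prefixes? : Decidable Prefixes
  Prefixes? q = search (ProperPrefix q) (properPrefix? q)

  suffix-code : ∀ x y c → X x → X y → c ≢ [] → c ++ x ≢ y
  suffix-code = proj₂ (proj₂ bifix)

  prefix-code : ∀ x y c → X x → X y → c ≢ [] → x ++ c ≢ y
  prefix-code = proj₁ (proj₂ bifix)

  -- Going one letter up the suffix tree: a·p is a code word or a proper suffix
  -- (never both, X being a suffix code); in S one of the two happens.
  suffix-of-code-word : ∀ a p → X (a ∷ p) → Suffixes p
  suffix-of-code-word a p ap∈X = a ∷ p , ap∈X , a , [] , refl

  suffix-parent : ∀ a p → Suffixes (a ∷ p) → Suffixes p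
  suffix-parent a p (x , x∈X , c , s , e) = x , x∈X , c , s ++ [ a ] , trans (cong (c ∷_) (++-assoc s [ a ] p)) e

  suffix-exclusive : ∀ a p → X (a ∷ p) → Suffixes (a ∷ p) → ⊥
  suffix-exclusive a p ap∈X (x , x∈X , c , s , e) = suffix-code (a ∷ p) x (c ∷ s) ap∈X x∈X (λ ()) e

  suffix-branch : ∀ a p y → S (a ∷ p ++ y) → Suffixes p → X (a ∷ p) ⊎ Suffixes (a ∷ p)
  suffix-branch a p y apy∈S (x₁ , x₁∈X , c , s , csp≡x₁) with suffix-covering (a ∷ p) (factorial [] (a ∷ p) y apy∈S)
  ... | inj₁ (x , x∈X , [] , x≡ap)      = inj₁ (subst X x≡ap x∈X)
  ... | inj₁ (x , x∈X , d ∷ s′ , ds′x≡ap) = ⊥-elim (suffix-code x x₁ (c ∷ s ++ s′) x∈X x₁∈X (λ ())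
          (trans (cong (c ∷_) (trans (++-assoc s s′ x) (cong (s ++_) (proj₂ (∷-injective ds′x≡ap))))) csp≡x₁))
  ... | inj₂ (x , x∈X , [] , ap≡x)      = inj₁ (subst X (sym ap≡x) x∈X)
  ... | inj₂ (x , x∈X , d ∷ s′ , e)     = inj₂ (x , x∈X , d , s′ , e)

  prefix-of-code-word : ∀ b q → X (q ++ [ b ]) → Prefixes q
  prefix-of-code-word b q qb∈X = q ++ [ b ] , qb∈X , b , [] , refl

  prefix-parent : ∀ b q → Prefixes (q ++ [ b ]) → Prefixes q
  prefix-parent b q (x , x∈X , c , t , e) = x , x∈X , b , c ∷ t , trans (sym (++-assoc q [ b ] (c ∷ t))) e

  prefix-exclusive : ∀ b q → X (q ++ [ b ]) → Prefixes (q ++ [ b ]) → ⊥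
  prefix-exclusive b q qb∈X (x , x∈X , c , t , e) = prefix-code (q ++ [ b ]) x (c ∷ t) qb∈X x∈X (λ ()) e

  prefix-branch : ∀ b q y → S (y ++ q ++ [ b ]) → Prefixes q → X (q ++ [ b ]) ⊎ Prefixes (q ++ [ b ])
  prefix-branch b q y yqb∈S (x₁ , x₁∈X , c , t , qct≡x₁)
    with prefix-covering (q ++ [ b ]) (factorial y (q ++ [ b ]) [] (subst S (cong (y ++_) (sym (++-identityʳ (q ++ [ b ])))) yqb∈S))
  ... | inj₁ (x , x∈X , [] , x≡qb)      = inj₁ (subst X (trans (sym (++-identityʳ x)) x≡qb) x∈X)
  ... | inj₁ (x , x∈X , d ∷ t′ , xdt′≡qb) with prefix-of-init x d t′ q b xdt′≡qb
  ...   | v , xv≡q = ⊥-elim (prefix-code x x₁ (v ++ c ∷ t) x∈X x₁∈X (λ e → case (++-conicalʳ v (c ∷ t) e))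
            (trans (sym (++-assoc x v (c ∷ t))) (trans (cong (_++ (c ∷ t)) xv≡q) qct≡x₁)))
    where
    case : c ∷ t ≢ []
    case ()
  prefix-branch b q y yqb∈S _ | inj₂ (x , x∈X , [] , qb≡x) = inj₁ (subst X (sym (trans (sym (++-identityʳ (q ++ [ b ]))) qb≡x)) x∈X)
  prefix-branch b q y yqb∈S _ | inj₂ (x , x∈X , d ∷ t′ , e) = inj₂ (x , x∈X , d , t′ , e)

  s ξ ι κ : Word k → ℤ
  s u = 𝟙 (S? u)
  ξ z = 𝟙 (X? z)
  ι p = 𝟙 (Suffixes? p)
  κ q = 𝟙 (Prefixes? q)

  ε∉X : ¬ X []
  ε∉X ε∈X = proj₁ bifix [] ε∈X refl

  ξ-ε : ξ [] ≡ 0ℤ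
  ξ-ε = 𝟙-no ε∉X (X? [])

  ι-ε : ι [] ≡ 1ℤ
  ι-ε with x₀ | x₀∈X
  ... | []    | ε∈X  = ⊥-elim (ε∉X ε∈X)
  ... | c ∷ s | cs∈X = 𝟙-yes (c ∷ s , cs∈X , c , s , ++-identityʳ (c ∷ s)) (Suffixes? [])

  κ-ε : κ [] ≡ 1ℤ
  κ-ε with x₀ | x₀∈X
  ... | []    | ε∈X  = ⊥-elim (ε∉X ε∈X)
  ... | c ∷ s | cs∈X = 𝟙-yes (c ∷ s , cs∈X , c , s , refl) (Prefixes? [])

  too-long : ∀ (z x : Word k) → bound < length z → X x → length z ≤ length x → ⊥
  too-long z x lt x∈X z≤x = ℕₚ.<-irrefl refl (ℕₚ.<-≤-trans lt (ℕₚ.≤-trans z≤x (bounded x x∈X)))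

  ξ-long : ∀ z → bound < length z → ξ z ≡ 0ℤ
  ξ-long z lt = 𝟙-no (λ z∈X → too-long z z lt z∈X ℕₚ.≤-refl) (X? z)

  ι-long : ∀ z → bound < length z → ι z ≡ 0ℤ
  ι-long z lt = 𝟙-no (λ { (x , x∈X , c , s , e) →
    too-long z x lt x∈X (ℕₚ.≤-trans (length-++-≤ʳ z {c ∷ s}) (ℕₚ.≤-reflexive (cong length e))) })
    (Suffixes? z)

  κ-long : ∀ z → bound < length z → κ z ≡ 0ℤ
  κ-long z lt = 𝟙-no (λ { (x , x∈X , c , t , e) →
    too-long z x lt x∈X (ℕₚ.≤-trans (length-++-≤ˡ z) (ℕₚ.≤-reflexive (cong length e))) })
    (Prefixes? z)

  left-step : ∀ a p y → ι p * s (a ∷ p ++ y) ≡ (ξ (a ∷ p) + ι (a ∷ p)) * s (a ∷ p ++ y)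
  left-step a p y = 𝟙-weighted (S? (a ∷ p ++ y)) (λ apy∈S →
    𝟙-exclusive-sum (suffix-branch a p y apy∈S) (suffix-of-code-word a p) (suffix-parent a p) (suffix-exclusive a p)
                    (Suffixes? p) (X? (a ∷ p)) (Suffixes? (a ∷ p)))

  right-step : ∀ b q y → κ q * s ((y ++ q) ++ [ b ]) ≡ (ξ (q ++ [ b ]) + κ (q ++ [ b ])) * s (y ++ q ++ [ b ])
  right-step b q y = trans (cong (λ w → κ q * s w) (++-assoc y q [ b ])) (𝟙-weighted (S? (y ++ q ++ [ b ])) (λ yqb∈S →
    𝟙-exclusive-sum (prefix-branch b q y yqb∈S) (prefix-of-code-word b q) (prefix-parent b q) (prefix-exclusive b q)
                    (Prefixes? q) (X? (q ++ [ b ])) (Prefixes? (q ++ [ b ]))))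

  open TreeIdentity bound s ξ ι κ ξ-ε ι-ε κ-ε ξ-long ι-long κ-long left-step right-step public

module CountsOf {k : ℕ} (S : WordSet k) (S? : Decidable S) where
  open ExtensionCounts (λ u → 𝟙 (S? u)) public

  mS-counts : ∀ u → mS S S? u ≡ e u - ℓ u - r u + 1ℤ
  mS-counts u = cong₂ (λ a b → a - b + 1ℤ)
    (cong₂ _-_ (count-Fin² (λ p → S? (proj₁ p ∷ (u ++ [ proj₂ p ])))) (count-Fin (λ a → S? (a ∷ u))))
    (count-Fin (λ a → S? (u ++ [ a ])))

  module _ (factorial : Factorial S) (u : Word k) (u∉S : ¬ S u) where

    e≡0 : e u ≡ 0ℤ
    e≡0 = Σ-vanish sumFin-linear (λ a → Σ-vanish sumFin-linear (λ b → 𝟙-no (λ h → u∉S (factorial [ a ] u [ b ] h)) _))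

    ℓ≡0 : ℓ u ≡ 0ℤ
    ℓ≡0 = Σ-vanish sumFin-linear (λ a → 𝟙-no (λ h → u∉S (factorial [ a ] u [] (subst S (cong (a ∷_) (sym (++-identityʳ u))) h))) _)

    r≡0 : r u ≡ 0ℤ
    r≡0 = Σ-vanish sumFin-linear (λ b → 𝟙-no (λ h → u∉S (factorial [] u [ b ] h)) _)

    mS-outside : mS S S? u ≡ 1ℤ
    mS-outside = trans (mS-counts u) (cong₂ (λ a b → a - b + 1ℤ) (cong₂ _-_ e≡0 ℓ≡0) r≡0)

    t-outside : t u ≡ 0ℤ
    t-outside = trans (cong₂ (λ a b → a - b + 𝟙 (S? u)) (cong₂ _-_ e≡0 ℓ≡0) r≡0) (cong (_+_ 0ℤ) (𝟙-no u∉S (S? u)))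

  neutral-t-vanish : Neutral S S? → ∀ u → u ≢ [] → t u ≡ 0ℤ
  neutral-t-vanish (factorial , neutral) u u≢ε = by-membership (S? u)
    where
    by-membership : Dec (S u) → t u ≡ 0ℤ
    by-membership (yes u∈S) = trans (cong (λ c → e u - ℓ u - r u + c) (𝟙-yes u∈S (S? u)))
                                    (trans (sym (mS-counts u)) (neutral u u≢ε u∈S))
    by-membership (no u∉S)  = t-outside factorial u u∉S

module FiniteWordSet {k : ℕ} (X : WordSet k) (finite : Finite X) where
  open Equivalence

  xs : List (Word k)
  xs = proj₁ finite

  search : ∀ (P : Word k → Set) → (∀ x → Dec (P x)) → Dec (∃ λ x → X x × P x)
  search P P? = map′ (λ any → let (x , x∈xs , px) = find any in x , from (proj₂ finite x) x∈xs , px)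
                     (λ { (x , x∈X , px) → lose (to (proj₂ finite x) x∈X) px })
                     (any? P? xs)

  max-length : List (Word k) → ℕ
  max-length []       = 0
  max-length (y ∷ ys) = length y ℕ.⊔ max-length ys

  max-length-≥ : ∀ ys x → x ∈ ys → length x ≤ max-length ys
  max-length-≥ (y ∷ ys) x (here refl) = ℕₚ.m≤m⊔n (length y) (max-length ys)
  max-length-≥ (y ∷ ys) x (there x∈ys) = ℕₚ.≤-trans (max-length-≥ ys x x∈ys) (ℕₚ.m≤n⊔m (length y) (max-length ys))

  bounded : ∀ x → X x → length x ≤ max-length xs
  bounded x x∈X = max-length-≥ xs x (to (proj₂ finite x) x∈X)

-- Sums over the letters of B are sums over the words of X, f being a bijection B → X.
module CodingSums {k m : ℕ} {X : WordSet k} (X? : Decidable X) (N : ℕ) (bounded : ∀ x → X x → length x ≤ N)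
  (f : Word m → Word k) (coding : IsCodingMorphism f X) where

  f-in-X : ∀ b → X (f [ b ])
  f-in-X = proj₁ (proj₂ coding)

  code-indicator : ∀ z → 𝟙 (X? z) ≡ sumFin {m} (λ b → 𝟙 (z ≟W f [ b ]))
  code-indicator z with X? z
  ... | no z∉X = sym (Σ-vanish sumFin-linear (λ b → 𝟙-no (λ z≡fb → z∉X (subst X (sym z≡fb) (f-in-X b))) _))
  ... | yes z∈X with proj₂ (proj₂ (proj₂ coding)) z z∈X
  ...   | b₀ , fb₀≡z = sym (trans (Σ-cong sumFin-linear (λ b → trans (same-letter b) (sym (*-identityʳ _))))
                                  (sumFin-delta b₀ (λ _ → 1ℤ)))
    where
    same-letter : ∀ b → 𝟙 (z ≟W f [ b ]) ≡ 𝟙 (b Finₚ.≟ b₀)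
    same-letter b = 𝟙-⇔ (λ z≡fb → proj₁ (proj₂ (proj₂ coding)) b b₀ (trans (sym z≡fb) (sym fb₀≡z)))
                        (λ { refl → sym fb₀≡z }) (z ≟W f [ b ]) (b Finₚ.≟ b₀)

  sum-over-letters : ∀ (g : Word k → ℤ) → sumFin {m} (λ b → g (f [ b ])) ≡ sumWords N (λ z → 𝟙 (X? z) * g z)
  sum-over-letters g = sym (begin
      sumWords N (λ z → 𝟙 (X? z) * g z)
    ≡⟨ Σ-cong W-lin (λ z → trans (cong (_* g z) (code-indicator z)) (trans (*-comm _ (g z)) (sym (Σ-* F-lin (g z) _)))) ⟩
      sumWords N (λ z → sumFin (λ b → g z * 𝟙 (z ≟W f [ b ])))
    ≡⟨ sumWords-interchange N sumFin F-lin _ ⟩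
      sumFin (λ b → sumWords N (λ z → g z * 𝟙 (z ≟W f [ b ])))
    ≡⟨ Σ-cong F-lin (λ b → trans (Σ-cong W-lin (λ z → *-comm (g z) _)) (sumWords-delta N (f [ b ]) g (bounded _ (f-in-X b)))) ⟩
      sumFin (λ b → g (f [ b ])) ∎)
    where
    W-lin : Linear (sumWords {k} N)
    W-lin = sumWords-linear N
    F-lin : Linear (sumFin {m})
    F-lin = sumFin-linear

preimage-factorial : ∀ {k m} (S : WordSet k) (f : Word m → Word k) → IsMonoidMorphism f → Factorial S → Factorial (preimage f S)
preimage-factorial S f (_ , f-++) factorial u v w h =
  factorial (f u) (f v) (f w) (subst S (trans (f-++ u (v ++ w)) (cong (f u ++_) (f-++ v w))) h)

-- Degenerate case: a factorial set without ε is empty, and so is its preimage;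
-- both are neutral of characteristic 0.
empty-case : ∀ {k m} (S : WordSet k) (S? : Decidable S) (f : Word m → Word k) → IsMonoidMorphism f →
  Factorial S → ¬ S [] → Neutral (preimage f S) (preimage? f S S?) × (χ (preimage f S) (preimage? f S S?) ≡ χ S S?)
empty-case S S? f morphism factorial ε∉S =
    (factorial-T , λ w _ fw∈S → ⊥-elim (S-empty (f w) fw∈S))
  , cong (_-_ 1ℤ) (trans (CountsOf.mS-outside T T? factorial-T [] (S-empty (f [])))
                         (sym (CountsOf.mS-outside S S? factorial [] ε∉S)))
  where
  T = preimage f S
  T? = preimage? f S S?
  factorial-T : Factorial T
  factorial-T = preimage-factorial S f morphism factorial
  S-empty : ∀ w → ¬ S w
  S-empty w w∈S = ε∉S (factorial w [] [] (subst S (sym (++-identityʳ w)) w∈S))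

module MainCase {k m : ℕ} (S : WordSet k) (S? : Decidable S) (recurrent-S : Recurrent S) (neutral-S : Neutral S S?)
  (X : WordSet k) (finite-X : Finite X) (maximal-X : SMaximalBifixCode S X)
  (f : Word m → Word k) (coding : IsCodingMorphism f X) (ε∈S : S []) where

  open FiniteWordSet X finite-X using (search; bounded; max-length; xs)

  factorial : Factorial S
  factorial = proj₁ (proj₂ recurrent-S)

  -- X is nonempty: otherwise every letter a occurring in S would make {a} a bifix
  -- code in S larger than X, so S would be {ε}.
  code-inhabited : ∃ X
  code-inhabited with search (λ _ → ⊤) (λ _ → yes tt)
  ... | yes (x , x∈X , _) = x , x∈X
  ... | no X-empty = ⊥-elim (proj₁ recurrent-S (λ w → mk⇔ (only-ε w) (λ { refl → ε∈S })))
    where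
    only-ε : ∀ w → S w → w ≡ []
    only-ε []      _     = refl
    only-ε (a ∷ w) aw∈S = ⊥-elim (X-empty ([ a ] , a∈X , tt))
      where
      ∅ : WordSet k
      ∅ _ = ⊥
      a∈X : X [ a ]
      a∈X = proj₂ (proj₂ maximal-X) (insert ∅ [ a ])
              (adjoin-bifix ∅ ((λ _ ()) , (λ _ _ _ ()) , (λ _ _ _ ())) [ a ] (λ ()) (λ _ ()) (λ _ ()) (λ _ ()) (λ _ ()))
              (λ { (inj₂ refl) → factorial [] [ a ] w aw∈S })
              (λ x∈X → ⊥-elim (X-empty (_ , x∈X , tt)))
              (inj₂ refl)

  hypotheses : MaximalBifixCode S X
  hypotheses = record
    { factorial = factorial
    ; recurrent = proj₂ (proj₂ recurrent-S)
    ; bifix     = proj₁ maximal-X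
    ; X⊆S       = proj₁ (proj₂ maximal-X)
    ; maximal   = proj₂ (proj₂ maximal-X)
    ; search    = search
    ; bound     = max-length xs
    ; bounded   = bounded
    ; x₀        = proj₁ code-inhabited
    ; x₀∈X      = proj₂ code-inhabited
    }

  open CodeTrees hypotheses S?
  open CodingSums X? (max-length xs) bounded f coding
  module C = CountsOf S S?

  T : WordSet m
  T = preimage f S

  T? : Decidable T
  T? = preimage? f S S?

  f-ε : f [] ≡ []
  f-ε = proj₁ (proj₁ coding)

  f-++ : ∀ u v → f (u ++ v) ≡ f u ++ f v
  f-++ = proj₂ (proj₁ coding)

  f-nonempty : ∀ w → w ≢ [] → f w ≢ []
  f-nonempty []      w≢ε _    = w≢ε refl
  f-nonempty (b ∷ w) _   fw≡ε =
    proj₁ (proj₁ maximal-X) (f [ b ]) (f-in-X b) (++-conicalˡ (f [ b ]) (f w) (trans (sym (f-++ [ b ] w)) fw≡ε))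

  mT-counts : ∀ w → mS T T? w ≡ eX (f w) - ℓX (f w) - rX (f w) + 1ℤ
  mT-counts w = cong₂ (λ a b → a - b + 1ℤ) (cong₂ _-_ eT ℓT) rT
    where
    y = f w
    ℓT : + ℓS T T? w ≡ ℓX y
    ℓT = trans (count-Fin (λ b → S? (f (b ∷ w))))
         (trans (Σ-cong sumFin-linear (λ b → cong s (f-++ [ b ] w))) (sum-over-letters (λ z → s (z ++ y))))
    rT : + rS T T? w ≡ rX y
    rT = trans (count-Fin (λ b → S? (f (w ++ [ b ]))))
         (trans (Σ-cong sumFin-linear (λ b → cong s (f-++ w [ b ]))) (sum-over-letters (λ z → s (y ++ z))))
    eT : + eS T T? w ≡ eX y
    eT = trans (count-Fin² (λ p → S? (f (proj₁ p ∷ (w ++ [ proj₂ p ])))))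
         (trans (Σ-cong sumFin-linear (λ b → Σ-cong sumFin-linear (λ c →
                   cong s (trans (f-++ [ b ] (w ++ [ c ])) (cong (f [ b ] ++_) (f-++ w [ c ]))))))
         (trans (Σ-cong sumFin-linear (λ b → sum-over-letters (λ z′ → s (f [ b ] ++ y ++ z′))))
                (sum-over-letters (λ z → W (λ z′ → ξ z′ * s (z ++ y ++ z′))))))

  neutral-T : Neutral T T?
  neutral-T = preimage-factorial S f (proj₁ coding) factorial , λ w w≢ε fw∈S → begin
      mS T T? w
    ≡⟨ mT-counts w ⟩
      eX (f w) - ℓX (f w) - rX (f w) + 1ℤ
    ≡⟨ reorder (eX (f w)) (ℓX (f w)) (rX (f w)) 1ℤ ⟩
      eX (f w) - rX (f w) - ℓX (f w) + 1ℤ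
    ≡⟨ cong (_+_ (eX (f w) - rX (f w) - ℓX (f w))) (sym (𝟙-yes fw∈S (S? (f w)))) ⟩
      eX (f w) - rX (f w) - ℓX (f w) + s (f w)
    ≡⟨ nonempty-identity (C.neutral-t-vanish neutral-S) (f w) (f-nonempty w w≢ε) ⟩
      + 0 ∎

  same-characteristic : χ T T? ≡ χ S S?
  same-characteristic = cong (_-_ 1ℤ) (begin
      mS T T? []
    ≡⟨ trans (mT-counts []) (cong (λ y → eX y - ℓX y - rX y + 1ℤ) f-ε) ⟩
      eX [] - ℓX [] - rX [] + 1ℤ
    ≡⟨ reorder (eX []) (ℓX []) (rX []) 1ℤ ⟩
      eX [] - rX [] - ℓX [] + 1ℤ
    ≡⟨ replace-constant (eX [] - rX [] - ℓX []) (e [] - ℓ [] - r []) (s []) 1ℤ (empty-identity (C.neutral-t-vanish neutral-S)) ⟩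
      e [] - ℓ [] - r [] + 1ℤ
    ≡⟨ sym (C.mS-counts []) ⟩
      mS S S? [] ∎)

theorem4 : (k m : ℕ) (S : WordSet k) (S? : Decidable S)
    → Recurrent S → Neutral S S?
    → (X : WordSet k) → Finite X → SMaximalBifixCode S X
    → (f : Word m → Word k) → IsCodingMorphism f X
    → Neutral (preimage f S) (preimage? f S S?)
    × (χ (preimage f S) (preimage? f S S?) ≡ χ S S?)
theorem4 k m S S? recurrent-S neutral-S X finite-X maximal-X f coding with S? []
... | yes ε∈S = MainCase.neutral-T S S? recurrent-S neutral-S X finite-X maximal-X f coding ε∈S
              , MainCase.same-characteristic S S? recurrent-S neutral-S X finite-X maximal-X f coding ε∈S
... | no ε∉S  = empty-case S S? f (proj₁ coding) (proj₁ (proj₂ recurrent-S)) ε∉S
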